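{- Let $n\ge0$, $X=(x_1,\dots,x_n)$, $\overline X=(1/x_1,\dots,1/x_n)$. For $\lambda\in\mathcal P_n$, $\mathfrak{so}_\lambda(X,\overline X,-1)=\mathrm{sp}_\lambda(X)$. For $\lambda\in\mathcal P_{n+1}$, $\mathfrak{sp}_\lambda(X,\overline X,-1)=\mathrm{oo}_\lambda(X,-1)$.
   Context: $\mathcal P_k$ = partitions with at most $k$ nonzero parts. $h_k$ complete homogeneous symmetric polynomial ($h_0=1$, $h_k=0$ for $k<0$). For a finite list of variables $Z$ and $N\ge\ell(\lambda)$: $\mathfrak{so}_\lambda(Z)=\det(h_{\lambda_i-i+j}(Z)+h_{\lambda_i-i-j+1}(Z))_{1\le i,j\le N}$, $\mathfrak{sp}_\lambda(Z)=\tfrac12\det(h_{\lambda_i-i+j}(Z)+h_{\lambda_i-i-j+2}(Z))_{1\le i,j\le N}$. For $k$ variables $W$, $\overline W=(1/w_1,\dots,1/w_k)$ and $\lambda\in\mathcal P_k$: $\mathrm{sp}_\lambda(W)=\tfrac12\det(h_{\lambda_i-i+j}(W,\overline W)+h_{\lambda_i-i-j+2}(W,\overline W))_{1\le i,j\le k}$ and $\mathrm{oo}_\lambda(W)=\det(h_{\lambda_i-i+j}(W,\overline W,1)-h_{\lambda_i-i-j}(W,\overline W,1))_{1\le i,j\le k}$ (so $\mathrm{oo}_\lambda(X,-1)$ has $n+1$ variables). -}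

module Defs where

open import Level using (Level)
open import Algebra.Bundles using (CommutativeRing)
open import Data.Nat as ℕ using (ℕ; zero; suc; _∸_)
open import Data.Fin as Fin using (Fin; toℕ; punchIn)
open import Data.Integer as ℤ using (ℤ; +_; -[1+_])
open import Data.List as List using (List; []; _∷_; _++_; [_])
open import Data.Vec as Vec using (Vec; toList; lookup)

-- A partition with at most N nonzero parts, given as its first N parts
-- (padded by zeros): a weakly decreasing function Fin N → ℕ.
IsPartition : {N : ℕ} → (Fin N → ℕ) → Set
IsPartition {N} μ = (i j : Fin N) → i Fin.≤ j → μ j ℕ.≤ μ i

-- index λ_i - i + c  with 1-based row index i (given as 0-based Fin)
-- we write entries in terms of integers
rowIdx : {N : ℕ} → (Fin N → ℕ) → Fin N → ℤ
rowIdx μ i = (+ μ i) ℤ.- (+ suc (toℕ i))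

col : {N : ℕ} → Fin N → ℤ
col j = + suc (toℕ j)

module Sym {c ℓ : Level} (R : CommutativeRing c ℓ) where
  open CommutativeRing R public

  pow : Carrier → ℕ → Carrier
  pow z zero = 1#
  pow z (suc k) = z * pow z k

  sumF : (n : ℕ) → (Fin n → Carrier) → Carrier
  sumF zero f = 0#
  sumF (suc n) f = f Fin.zero + sumF n (λ j → f (Fin.suc j))

  sgn : ℕ → Carrier
  sgn zero = 1#
  sgn (suc k) = - sgn k

  det : (n : ℕ) → (Fin n → Fin n → Carrier) → Carrier
  det zero M = 1#
  det (suc n) M = sumF (suc n) (λ j →
    sgn (toℕ j) * (M Fin.zero j * det n (λ a b → M (Fin.suc a) (punchIn j b))))

  hN : ℕ → List Carrier → Carrier
  hN zero [] = 1#
  hN (suc k) [] = 0#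
  hN k (z ∷ Z) = sumF (suc k) (λ m → pow z (toℕ m) * hN (k ∸ toℕ m) Z)

  h : ℤ → List Carrier → Carrier
  h (+ k) Z = hN k Z
  h -[1+ k ] Z = 0#

  -- 𝔰𝔬_λ(Z) with N = number of listed parts of λ (N ≥ ℓ(λ))
  soF : (N : ℕ) → (Fin N → ℕ) → List Carrier → Carrier
  soF N μ Z = det N (λ i j →
    h (rowIdx μ i ℤ.+ col j) Z + h (rowIdx μ i ℤ.- col j ℤ.+ + 1) Z)

  -- 𝔰𝔭_λ(Z); half is a given inverse of 2.  For N = 0 (empty determinant)
  -- the value is 1 (the ½ compensates the doubled first column, absent when N = 0)
  spF : (N : ℕ) → Carrier → (Fin N → ℕ) → List Carrier → Carrier
  spF zero half μ Z = 1#
  spF (suc N) half μ Z = half * det (suc N) (λ i j →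
    h (rowIdx μ i ℤ.+ col j) Z + h (rowIdx μ i ℤ.- col j ℤ.+ + 2) Z)

  spW : (k : ℕ) → Carrier → (Fin k → ℕ) → Vec Carrier k → Vec Carrier k → Carrier
  spW zero half μ W Winv = 1#
  spW (suc k) half μ W Winv = half * det (suc k) (λ i j →
    h (rowIdx μ i ℤ.+ col j) Z + h (rowIdx μ i ℤ.- col j ℤ.+ + 2) Z)
    where Z = toList W ++ toList Winv

  ooW : (k : ℕ) → (Fin k → ℕ) → Vec Carrier k → Vec Carrier k → Carrier
  ooW k μ W Winv = det k (λ i j →
    h (rowIdx μ i ℤ.+ col j) Z - h (rowIdx μ i ℤ.- col j) Z)
    where Z = toList W ++ toList Winv ++ [ 1# ]

{-# OPTIONS --safe #-}
-- Adjoining a variable c to a list Z multiplies the series Σₘ hₘ tᵐ by (1 - c t)⁻¹, so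
-- hₘ(Z) = hₘ(Z, c) - c hₘ₋₁(Z, c).  Substituted into a Jacobi–Trudi determinant with entries
-- h_{r+j} + ε h_{r-j+t}, this turns column j > 1 into column j plus (-c)·column j-1 of the
-- determinant with offset t - 1 and sign ε(-c) (and doubles column 1 when t = 2, ε = 1).
-- Column operations remove the added neighbours, and ½ absorbs the doubling.  Removing
-- c = -1 from (X, X̄, -1) gives 𝔰𝔬 = sp; for 𝔰𝔭 = oo one first adjoins c = 1 and then removes
-- the -1 from (X, -1, X̄, -1, 1), the variables of oo(X, -1).
module Submission where

open import Defs
open import Level using (Level)
open import Algebra.Bundles using (CommutativeRing)
open import Data.Empty using (⊥-elim)
open import Data.Fin as Fin using (Fin; zero; suc; toℕ; punchIn; punchOut; fromℕ<)
import Data.Fin.Properties as Finₚ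
open import Data.Integer as ℤ using (ℤ; +_; 1ℤ)
import Data.Integer.Properties as ℤₚ
open import Data.Integer.Tactic.RingSolver using (solve-∀)
open import Data.List using ([]; _∷_; _++_; [_])
import Data.List.Properties as Listₚ
open import Data.Nat as ℕ using (ℕ; zero; suc; _∸_; _<_; _≤_; _<?_)
import Data.Nat.Properties as ℕₚ
open import Data.Product using (_×_; _,_)
open import Data.Sum using (_⊎_; inj₁; inj₂)
open import Data.Vec using (Vec; toList; lookup; _∷ʳ_)
open import Data.Vec.Functional using (updateAt)
open import Data.Vec.Functional.Properties using (updateAt-updates; updateAt-minimal)
import Data.Vec.Properties as Vecₚ
open import Function using (_∘_)
open import Relation.Nullary using (¬_; yes; no)
open import Relation.Binary.PropositionalEquality as ≡ using (_≡_; _≢_)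

module _ {c ℓ : Level} (R : CommutativeRing c ℓ) where
  open Sym R hiding (zero)
  open import Algebra.Properties.Ring ring using (-1*x≈-x; -‿involutive; -‿distribˡ-*)
  open import Algebra.Solver.Ring.NaturalCoefficients.Default commutativeSemiring
    using (solve; _:+_; _:*_; _:=_; con)
  open import Relation.Binary.Reasoning.Setoid setoid

  sumF-cong : ∀ n {f g : Fin n → Carrier} → (∀ j → f j ≈ g j) → sumF n f ≈ sumF n g
  sumF-cong zero    f≈g = refl
  sumF-cong (suc n) f≈g = +-cong (f≈g zero) (sumF-cong n (f≈g ∘ suc))

  sumF-zero : ∀ n {f : Fin n → Carrier} → (∀ j → f j ≈ 0#) → sumF n f ≈ 0#
  sumF-zero zero    f≈0 = refl
  sumF-zero (suc n) f≈0 = trans (+-cong (f≈0 zero) (sumF-zero n (f≈0 ∘ suc))) (+-identityʳ 0#)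

  *-distribˡ-sumF : ∀ n a (f : Fin n → Carrier) → sumF n (λ j → a * f j) ≈ a * sumF n f
  *-distribˡ-sumF zero    a f = sym (zeroʳ a)
  *-distribˡ-sumF (suc n) a f =
    trans (+-congˡ (*-distribˡ-sumF n a (f ∘ suc))) (sym (distribˡ a _ _))

  sumF-linear : ∀ n a b (f g : Fin n → Carrier) →
                sumF n (λ j → a * f j + b * g j) ≈ a * sumF n f + b * sumF n g
  sumF-linear zero    a b f g = sym (trans (+-cong (zeroʳ a) (zeroʳ b)) (+-identityʳ 0#))
  sumF-linear (suc n) a b f g = begin
    (a * f zero + b * g zero) + sumF n (λ j → a * f (suc j) + b * g (suc j))
      ≈⟨ +-congˡ (sumF-linear n a b (f ∘ suc) (g ∘ suc)) ⟩
    (a * f zero + b * g zero) + (a * sumF n (f ∘ suc) + b * sumF n (g ∘ suc))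
      ≈⟨ solve 6 (λ a b x y s t → (a :* x :+ b :* y) :+ (a :* s :+ b :* t)
                                  := a :* (x :+ s) :+ b :* (y :+ t))
                 refl a b (f zero) (g zero) (sumF n (f ∘ suc)) (sumF n (g ∘ suc)) ⟩
    a * (f zero + sumF n (f ∘ suc)) + b * (g zero + sumF n (g ∘ suc)) ∎

  sumF-adjacent-cancel : ∀ n (f : Fin n → Carrier) (p q : Fin n) → toℕ q ≡ suc (toℕ p) →
                         (∀ j → j ≢ p → j ≢ q → f j ≈ 0#) → f p + f q ≈ 0# → sumF n f ≈ 0#
  sumF-adjacent-cancel (suc (suc n)) f zero (suc zero) _ f≈0 fp+fq≈0 = begin
    f zero + (f (suc zero) + sumF n (λ j → f (suc (suc j)))) ≈⟨ sym (+-assoc _ _ _) ⟩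
    (f zero + f (suc zero)) + sumF n (λ j → f (suc (suc j)))
      ≈⟨ +-cong fp+fq≈0 (sumF-zero n (λ j → f≈0 (suc (suc j)) (λ ()) (λ ()))) ⟩
    0# + 0#                                         ≈⟨ +-identityʳ 0# ⟩
    0#                                              ∎
  sumF-adjacent-cancel (suc n) f (suc p) (suc q) q≡1+p f≈0 fp+fq≈0 =
    trans (+-cong (f≈0 zero (λ ()) (λ ()))
                  (sumF-adjacent-cancel n (f ∘ suc) p q (ℕₚ.suc-injective q≡1+p)
                    (λ j j≢p j≢q → f≈0 (suc j) (j≢p ∘ Finₚ.suc-injective)
                                                (j≢q ∘ Finₚ.suc-injective))
                    fp+fq≈0))
          (+-identityʳ 0#)

  Matrix : ℕ → Set c
  Matrix n = Fin n → Fin n → Carrier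

  minor : ∀ {n} → Matrix (suc n) → Fin (suc n) → Matrix n
  minor M j a b = M (suc a) (punchIn j b)

  det-cong : ∀ n {M M′ : Matrix n} → (∀ i j → M i j ≈ M′ i j) → det n M ≈ det n M′
  det-cong zero    M≈M′ = refl
  det-cong (suc n) M≈M′ = sumF-cong (suc n) λ j →
    *-congˡ {sgn (toℕ j)} (*-cong (M≈M′ zero j) (det-cong n λ a b → M≈M′ (suc a) (punchIn j b)))

  det-linear-column : ∀ n (p : Fin n) {M M₁ M₂ : Matrix n} a b →
                      (∀ i j → j ≢ p → M i j ≈ M₁ i j) → (∀ i j → j ≢ p → M i j ≈ M₂ i j) →
                      (∀ i → M i p ≈ a * M₁ i p + b * M₂ i p) →
                      det n M ≈ a * det n M₁ + b * det n M₂
  det-linear-column (suc n) p {M} {M₁} {M₂} a b M≈M₁ M≈M₂ Mp≈ =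
    trans (sumF-cong (suc n) expand) (sumF-linear (suc n) a b (term M₁) (term M₂))
    where
    term : Matrix (suc n) → Fin (suc n) → Carrier
    term N j = sgn (toℕ j) * (N zero j * det n (minor N j))

    expand : ∀ j → term M j ≈ a * term M₁ j + b * term M₂ j
    expand j with j Fin.≟ p
    ... | yes ≡.refl = begin
      s * (M zero j * d)                 ≈⟨ *-congˡ (*-congʳ (Mp≈ zero)) ⟩
      s * ((a * x₁ + b * x₂) * d)
        ≈⟨ solve 6 (λ s a b x₁ x₂ d → s :* ((a :* x₁ :+ b :* x₂) :* d)
                                     := a :* (s :* (x₁ :* d)) :+ b :* (s :* (x₂ :* d)))
                   refl s a b x₁ x₂ d ⟩
      a * (s * (x₁ * d)) + b * (s * (x₂ * d))
        ≈⟨ +-cong (*-congˡ (*-congˡ (*-congˡ (minor≈ M≈M₁))))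
                  (*-congˡ (*-congˡ (*-congˡ (minor≈ M≈M₂)))) ⟩
      a * term M₁ j + b * term M₂ j      ∎
      where
      s = sgn (toℕ j)
      d = det n (minor M j)
      x₁ = M₁ zero j
      x₂ = M₂ zero j
      minor≈ : ∀ {N} → (∀ i k → k ≢ j → M i k ≈ N i k) → d ≈ det n (minor N j)
      minor≈ M≈N = det-cong n λ a b → M≈N (suc a) (punchIn j b) (Finₚ.punchInᵢ≢i j b)
    ... | no j≢p = begin
      s * (x * d)                        ≈⟨ *-congˡ (*-congˡ minor-expand) ⟩
      s * (x * (a * d₁ + b * d₂))
        ≈⟨ solve 6 (λ s a b x d₁ d₂ → s :* (x :* (a :* d₁ :+ b :* d₂))
                                     := a :* (s :* (x :* d₁)) :+ b :* (s :* (x :* d₂)))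
                   refl s a b x d₁ d₂ ⟩
      a * (s * (x * d₁)) + b * (s * (x * d₂))
        ≈⟨ +-cong (*-congˡ (*-congˡ (*-congʳ (M≈M₁ zero j j≢p))))
                  (*-congˡ (*-congˡ (*-congʳ (M≈M₂ zero j j≢p)))) ⟩
      a * term M₁ j + b * term M₂ j      ∎
      where
      s = sgn (toℕ j)
      x = M zero j
      d = det n (minor M j)
      d₁ = det n (minor M₁ j)
      d₂ = det n (minor M₂ j)
      p′ = punchOut j≢p
      avoids-p : ∀ b → b ≢ p′ → punchIn j b ≢ p
      avoids-p b b≢p′ eq = b≢p′ (Finₚ.punchIn-injective j b p′
                                   (≡.trans eq (≡.sym (Finₚ.punchIn-punchOut j≢p))))
      minor-expand : d ≈ a * d₁ + b * d₂
      minor-expand = det-linear-column n p′ a b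
        (λ x y y≢p′ → M≈M₁ (suc x) (punchIn j y) (avoids-p y y≢p′))
        (λ x y y≢p′ → M≈M₂ (suc x) (punchIn j y) (avoids-p y y≢p′))
        (λ x → ≡.subst (λ k → M (suc x) k ≈ a * M₁ (suc x) k + b * M₂ (suc x) k)
                        (≡.sym (Finₚ.punchIn-punchOut j≢p)) (Mp≈ (suc x)))

  det-scale-column : ∀ n (p : Fin n) {M M₁ : Matrix n} a →
                     (∀ i j → j ≢ p → M i j ≈ M₁ i j) → (∀ i → M i p ≈ a * M₁ i p) →
                     det n M ≈ a * det n M₁
  det-scale-column n p a M≈M₁ Mp≈ =
    trans (det-linear-column n p a 0# M≈M₁ M≈M₁ (λ i → trans (Mp≈ i) (sym (drop-0* _ _))))
          (drop-0* _ _)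
    where
    drop-0* : ∀ x y → x + 0# * y ≈ x
    drop-0* x y = trans (+-congˡ (zeroˡ y)) (+-identityʳ x)

  punchIn-adjacent : ∀ {n} (p q : Fin (suc n)) → toℕ q ≡ suc (toℕ p) → (b : Fin n) →
                     punchIn p b ≡ punchIn q b ⊎ (punchIn p b ≡ q × punchIn q b ≡ p)
  punchIn-adjacent zero    (suc zero) _ zero    = inj₂ (≡.refl , ≡.refl)
  punchIn-adjacent zero    (suc zero) _ (suc b) = inj₁ ≡.refl
  punchIn-adjacent (suc p) (suc q)    _ zero    = inj₁ ≡.refl
  punchIn-adjacent (suc p) (suc q) q≡1+p (suc b)
    with punchIn-adjacent p q (ℕₚ.suc-injective q≡1+p) b
  ... | inj₁ eq         = inj₁ (≡.cong suc eq)
  ... | inj₂ (eq₁ , eq₂) = inj₂ (≡.cong suc eq₁ , ≡.cong suc eq₂)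

  punchOut-adjacent : ∀ {n} {j p q : Fin (suc n)} (j≢p : j ≢ p) (j≢q : j ≢ q) →
                      toℕ q ≡ suc (toℕ p) → toℕ (punchOut j≢q) ≡ suc (toℕ (punchOut j≢p))
  punchOut-adjacent {j = zero} {zero} j≢p _ _ = ⊥-elim (j≢p ≡.refl)
  punchOut-adjacent {j = zero} {suc p} {suc q} _ _ q≡1+p = ℕₚ.suc-injective q≡1+p
  punchOut-adjacent {suc n} {suc zero} {zero} {suc zero} _ j≢q _ = ⊥-elim (j≢q ≡.refl)
  punchOut-adjacent {suc (suc n)} {suc (suc j)} {zero} {suc zero} _ _ _ = ≡.refl
  punchOut-adjacent {suc n} {suc j} {suc p} {suc q} j≢p j≢q q≡1+p =
    ≡.cong suc (punchOut-adjacent (j≢p ∘ ≡.cong suc) (j≢q ∘ ≡.cong suc)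
                                  (ℕₚ.suc-injective q≡1+p))

  det-adjacent-equal-columns : ∀ n (M : Matrix n) (p q : Fin n) → toℕ q ≡ suc (toℕ p) →
                               (∀ i → M i p ≈ M i q) → det n M ≈ 0#
  det-adjacent-equal-columns (suc n) M p q q≡1+p Mp≈Mq =
    sumF-adjacent-cancel (suc n) term p q q≡1+p other-terms-vanish pair-cancels
    where
    term : Fin (suc n) → Carrier
    term j = sgn (toℕ j) * (M zero j * det n (minor M j))

    other-terms-vanish : ∀ j → j ≢ p → j ≢ q → term j ≈ 0#
    other-terms-vanish j j≢p j≢q = begin
      sgn (toℕ j) * (M zero j * det n (minor M j)) ≈⟨ *-congˡ (*-congˡ minor≈0) ⟩
      sgn (toℕ j) * (M zero j * 0#)                ≈⟨ *-congˡ (zeroʳ _) ⟩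
      sgn (toℕ j) * 0#                             ≈⟨ zeroʳ _ ⟩
      0#                                           ∎
      where
      minor≈0 = det-adjacent-equal-columns n (minor M j) (punchOut j≢p) (punchOut j≢q)
        (punchOut-adjacent j≢p j≢q q≡1+p)
        (λ i → ≡.subst₂ (λ k l → M (suc i) k ≈ M (suc i) l)
                 (≡.sym (Finₚ.punchIn-punchOut j≢p)) (≡.sym (Finₚ.punchIn-punchOut j≢q))
                 (Mp≈Mq (suc i)))

    minors≈ : det n (minor M p) ≈ det n (minor M q)
    minors≈ = det-cong n λ a b → case (punchIn-adjacent p q q≡1+p b)
      where
      case : ∀ {a b} → punchIn p b ≡ punchIn q b ⊎ (punchIn p b ≡ q × punchIn q b ≡ p) →
             M (suc a) (punchIn p b) ≈ M (suc a) (punchIn q b)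
      case {a} (inj₁ eq) = reflexive (≡.cong (M (suc a)) eq)
      case {a} (inj₂ (eq₁ , eq₂)) = begin
        M (suc a) (punchIn p _) ≡⟨ ≡.cong (M (suc a)) eq₁ ⟩
        M (suc a) q             ≈⟨ sym (Mp≈Mq (suc a)) ⟩
        M (suc a) p             ≡⟨ ≡.cong (M (suc a)) (≡.sym eq₂) ⟩
        M (suc a) (punchIn q _) ∎

    pair-cancels : term p + term q ≈ 0#
    pair-cancels = begin
      s * (M zero p * d) + sgn (toℕ q) * (M zero q * det n (minor M q))
        ≈⟨ +-congˡ (*-cong (reflexive (≡.cong sgn q≡1+p))
                           (*-cong (sym (Mp≈Mq zero)) (sym minors≈))) ⟩
      s * (M zero p * d) + - s * (M zero p * d) ≈⟨ +-congˡ (sym (-‿distribˡ-* _ _)) ⟩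
      s * (M zero p * d) + - (s * (M zero p * d)) ≈⟨ -‿inverseʳ _ ⟩
      0# ∎
      where
      s = sgn (toℕ p)
      d = det n (minor M p)

  det-add-adjacent-column : ∀ n {M M′ : Matrix n} (p q : Fin n) a → toℕ q ≡ suc (toℕ p) →
                            (∀ i j → j ≢ q → M′ i j ≈ M i j) →
                            (∀ i → M′ i q ≈ M i q + a * M i p) →
                            det n M′ ≈ det n M
  det-add-adjacent-column n {M} {M′} p q a q≡1+p M′≈M M′q≈ = begin
    det n M′                     ≈⟨ det-linear-column n q 1# a M′≈M M′≈copy column-q ⟩
    1# * det n M + a * det n copy ≈⟨ +-cong (*-identityˡ _) (*-congˡ copy≈0) ⟩
    det n M + a * 0#             ≈⟨ +-congˡ (zeroʳ a) ⟩
    det n M + 0#                 ≈⟨ +-identityʳ _ ⟩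
    det n M                      ∎
    where
    copy : Matrix n
    copy i = updateAt (M i) q (λ _ → M i p)

    p≢q : p ≢ q
    p≢q p≡q = ℕₚ.<-irrefl (≡.cong toℕ p≡q) (ℕₚ.≤-reflexive (≡.sym q≡1+p))

    M′≈copy : ∀ i j → j ≢ q → M′ i j ≈ copy i j
    M′≈copy i j j≢q = trans (M′≈M i j j≢q) (reflexive (≡.sym (updateAt-minimal j q (M i) j≢q)))

    column-q : ∀ i → M′ i q ≈ 1# * M i q + a * copy i q
    column-q i = trans (M′q≈ i) (+-cong (sym (*-identityˡ _))
                                        (*-congˡ (reflexive (≡.sym (updateAt-updates q (M i))))))

    copy≈0 : det n copy ≈ 0#
    copy≈0 = det-adjacent-equal-columns n copy p q q≡1+p λ i →
      reflexive (≡.trans (updateAt-minimal p q (M i) p≢q) (≡.sym (updateAt-updates q (M i))))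

  -- (1 + a T) g for the unit shift T, reading g as 0 at negative indices
  shiftℕ : Carrier → (ℕ → Carrier) → ℕ → Carrier
  shiftℕ a g zero    = g zero
  shiftℕ a g (suc k) = g (suc k) + a * g k

  module _ {N : ℕ} (a : Carrier) (G : Fin N → ℕ → Carrier) where

    shiftedFrom : ℕ → Matrix N
    shiftedFrom m i j with toℕ j <? m
    ... | yes _ = G i (toℕ j)
    ... | no  _ = shiftℕ a (G i) (toℕ j)

    shiftedFrom-< : ∀ m i j → toℕ j < m → shiftedFrom m i j ≡ G i (toℕ j)
    shiftedFrom-< m i j j<m with toℕ j <? m
    ... | yes _   = ≡.refl
    ... | no  j≮m = ⊥-elim (j≮m j<m)

    shiftedFrom-≮ : ∀ m i j → ¬ toℕ j < m → shiftedFrom m i j ≡ shiftℕ a (G i) (toℕ j)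
    shiftedFrom-≮ m i j j≮m with toℕ j <? m
    ... | yes j<m = ⊥-elim (j≮m j<m)
    ... | no  _   = ≡.refl

    shiftedFrom-≢ : ∀ m i j → toℕ j ≢ m → shiftedFrom m i j ≡ shiftedFrom (suc m) i j
    shiftedFrom-≢ m i j j≢m with toℕ j <? m | toℕ j <? suc m
    ... | yes _   | yes _     = ≡.refl
    ... | no  _   | no  _     = ≡.refl
    ... | yes j<m | no  j≮1+m = ⊥-elim (j≮1+m (ℕₚ.m<n⇒m<1+n j<m))
    ... | no  j≮m | yes j<1+m = ⊥-elim (j≢m (ℕₚ.≤-antisym (ℕₚ.≤-pred j<1+m) (ℕₚ.≮⇒≥ j≮m)))

    det-shiftedFrom-suc : ∀ m → m < N → det N (shiftedFrom m) ≈ det N (shiftedFrom (suc m))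
    det-shiftedFrom-suc zero _ = det-cong N λ where
      i zero    → refl
      i (suc j) → reflexive (shiftedFrom-≢ 0 i (suc j) λ ())
    det-shiftedFrom-suc (suc m) 1+m<N =
      det-add-adjacent-column N p q a q≡1+p
        (λ i j j≢q → reflexive (shiftedFrom-≢ (suc m) i j (j≢q ∘ toℕ-injective)))
        column-q
      where
      m<N = ℕₚ.<-trans (ℕₚ.n<1+n m) 1+m<N
      p = fromℕ< m<N
      q = fromℕ< 1+m<N
      toℕp≡m : toℕ p ≡ m
      toℕp≡m = Finₚ.toℕ-fromℕ< m<N
      toℕq≡1+m : toℕ q ≡ suc m
      toℕq≡1+m = Finₚ.toℕ-fromℕ< 1+m<N
      q≡1+p : toℕ q ≡ suc (toℕ p)
      q≡1+p = ≡.trans toℕq≡1+m (≡.cong suc (≡.sym toℕp≡m))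
      toℕ-injective : ∀ {j} → toℕ j ≡ suc m → j ≡ q
      toℕ-injective eq = Finₚ.toℕ-injective (≡.trans eq (≡.sym toℕq≡1+m))
      column-q : ∀ i → shiftedFrom (suc m) i q
                       ≈ shiftedFrom (suc (suc m)) i q + a * shiftedFrom (suc (suc m)) i p
      column-q i
        rewrite shiftedFrom-≮ (suc m) i q (ℕₚ.<-irrefl toℕq≡1+m)
              | shiftedFrom-< (suc (suc m)) i q (ℕₚ.≤-reflexive (≡.cong suc toℕq≡1+m))
              | shiftedFrom-< (suc (suc m)) i p
                  (ℕₚ.m<n⇒m<1+n (ℕₚ.≤-reflexive (≡.cong suc toℕp≡m)))
              | toℕq≡1+m | toℕp≡m = refl

    det-shiftedFrom : ∀ m → m ≤ N → det N (shiftedFrom 0) ≈ det N (shiftedFrom m)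
    det-shiftedFrom zero    _     = refl
    det-shiftedFrom (suc m) 1+m≤N =
      trans (det-shiftedFrom m (ℕₚ.<⇒≤ 1+m≤N)) (det-shiftedFrom-suc m 1+m≤N)

    det-shiftℕ : det N (λ i j → shiftℕ a (G i) (toℕ j)) ≈ det N (λ i j → G i (toℕ j))
    det-shiftℕ = begin
      det N (λ i j → shiftℕ a (G i) (toℕ j))
        ≈⟨ det-cong N (λ i j → reflexive (≡.sym (shiftedFrom-≮ 0 i j λ ()))) ⟩
      det N (shiftedFrom 0)  ≈⟨ det-shiftedFrom N ℕₚ.≤-refl ⟩
      det N (shiftedFrom N)
        ≈⟨ det-cong N (λ i j → reflexive (shiftedFrom-< N i j (Finₚ.toℕ<n j))) ⟩
      det N (λ i j → G i (toℕ j)) ∎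

  hN-∷ : ∀ k z Z → hN k (z ∷ Z) ≡ sumF (suc k) (λ m → pow z (toℕ m) * hN (k ∸ toℕ m) Z)
  hN-∷ zero    z Z = ≡.refl
  hN-∷ (suc k) z Z = ≡.refl

  hN-zero : ∀ Z → hN 0 Z ≈ 1#
  hN-zero []      = refl
  hN-zero (z ∷ Z) = trans (+-identityʳ _) (trans (*-identityˡ _) (hN-zero Z))

  hN-suc-∷ : ∀ k z Z → hN (suc k) (z ∷ Z) ≈ hN (suc k) Z + z * hN k (z ∷ Z)
  hN-suc-∷ k z Z = +-cong (*-identityˡ _) (begin
    sumF (suc k) (λ m → (z * pow z (toℕ m)) * hN (k ∸ toℕ m) Z)
      ≈⟨ sumF-cong (suc k) (λ m → *-assoc z (pow z (toℕ m)) (hN (k ∸ toℕ m) Z)) ⟩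
    sumF (suc k) (λ m → z * (pow z (toℕ m) * hN (k ∸ toℕ m) Z))
      ≈⟨ *-distribˡ-sumF (suc k) z (λ m → pow z (toℕ m) * hN (k ∸ toℕ m) Z) ⟩
    z * sumF (suc k) (λ m → pow z (toℕ m) * hN (k ∸ toℕ m) Z)
      ≡⟨ ≡.cong (z *_) (≡.sym (hN-∷ k z Z)) ⟩
    z * hN k (z ∷ Z) ∎)

  hN-insert-under-∷ : ∀ z {Z Z′} c → (∀ k → hN (suc k) Z′ ≈ hN (suc k) Z + c * hN k Z′) →
                      ∀ k → hN (suc k) (z ∷ Z′) ≈ hN (suc k) (z ∷ Z) + c * hN k (z ∷ Z′)
  hN-insert-under-∷ z {Z} {Z′} c insert k = begin
    hN (suc k) (z ∷ Z′)                                 ≈⟨ hN-suc-∷ k z Z′ ⟩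
    hN (suc k) Z′ + z * hN k (z ∷ Z′)                   ≈⟨ +-congʳ (insert k) ⟩
    (hN (suc k) Z + c * hN k Z′) + z * hN k (z ∷ Z′)     ≈⟨ +-assoc _ _ _ ⟩
    hN (suc k) Z + (c * hN k Z′ + z * hN k (z ∷ Z′))     ≈⟨ +-congˡ (exchange k) ⟩
    hN (suc k) Z + (z * hN k (z ∷ Z) + c * hN k (z ∷ Z′)) ≈⟨ sym (+-assoc _ _ _) ⟩
    (hN (suc k) Z + z * hN k (z ∷ Z)) + c * hN k (z ∷ Z′) ≈⟨ +-congʳ (sym (hN-suc-∷ k z Z)) ⟩
    hN (suc k) (z ∷ Z) + c * hN k (z ∷ Z′)               ∎
    where
    exchange : ∀ k → c * hN k Z′ + z * hN k (z ∷ Z′) ≈ z * hN k (z ∷ Z) + c * hN k (z ∷ Z′)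
    exchange zero = begin
      c * hN 0 Z′ + z * hN 0 (z ∷ Z′)
        ≈⟨ +-cong (*-congˡ (hN-zero Z′)) (*-congˡ (hN-zero (z ∷ Z′))) ⟩
      c * 1# + z * 1#
        ≈⟨ +-comm _ _ ⟩
      z * 1# + c * 1#
        ≈⟨ sym (+-cong (*-congˡ (hN-zero (z ∷ Z))) (*-congˡ (hN-zero (z ∷ Z′)))) ⟩
      z * hN 0 (z ∷ Z) + c * hN 0 (z ∷ Z′) ∎
    exchange (suc k) = begin
      c * u + z * v                       ≈⟨ +-congˡ (*-congˡ (hN-insert-under-∷ z c insert k)) ⟩
      c * u + z * (w + c * v′)
        ≈⟨ solve 5 (λ c z u w v′ → c :* u :+ z :* (w :+ c :* v′) := z :* w :+ c :* (u :+ z :* v′))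
                   refl c z u w v′ ⟩
      z * w + c * (u + z * v′)            ≈⟨ +-congˡ (*-congˡ (sym (hN-suc-∷ k z Z′))) ⟩
      z * w + c * v                       ∎
      where
      u = hN (suc k) Z′
      v = hN (suc k) (z ∷ Z′)
      w = hN (suc k) (z ∷ Z)
      v′ = hN k (z ∷ Z′)

  hN-insert : ∀ A c B k → hN (suc k) (A ++ c ∷ B) ≈ hN (suc k) (A ++ B) + c * hN k (A ++ c ∷ B)
  hN-insert []      c B = λ k → hN-suc-∷ k c B
  hN-insert (z ∷ A) c B = hN-insert-under-∷ z c (hN-insert A c B)

  h-insert : ∀ A c B m → h m (A ++ c ∷ B) ≈ h m (A ++ B) + c * h (m ℤ.- 1ℤ) (A ++ c ∷ B)
  h-insert A c B (+ zero) = begin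
    hN 0 (A ++ c ∷ B)      ≈⟨ hN-zero (A ++ c ∷ B) ⟩
    1#                     ≈⟨ sym (hN-zero (A ++ B)) ⟩
    hN 0 (A ++ B)          ≈⟨ sym (+-identityʳ _) ⟩
    hN 0 (A ++ B) + 0#     ≈⟨ +-congˡ (sym (zeroʳ c)) ⟩
    hN 0 (A ++ B) + c * 0# ∎
  h-insert A c B (+ suc k) = hN-insert A c B k
  h-insert A c B ℤ.-[1+ k ] = sym (trans (+-congˡ (zeroʳ c)) (+-identityʳ 0#))

  shiftℤ : Carrier → (ℤ → Carrier) → ℤ → Carrier
  shiftℤ a φ m = φ m + a * φ (m ℤ.- 1ℤ)

  h-remove : ∀ {Z Z′} A c B → Z ≡ A ++ B → Z′ ≡ A ++ c ∷ B →
             ∀ m → h m Z ≈ shiftℤ (- c) (λ m → h m Z′) m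
  h-remove A c B ≡.refl ≡.refl m = begin
    x                                 ≈⟨ sym (+-identityʳ x) ⟩
    x + 0#                            ≈⟨ +-congˡ (sym (-‿inverseʳ (c * y))) ⟩
    x + (c * y + - (c * y))           ≈⟨ sym (+-assoc _ _ _) ⟩
    (x + c * y) + - (c * y)           ≈⟨ +-cong (sym (h-insert A c B m)) (-‿distribˡ-* c y) ⟩
    h m (A ++ c ∷ B) + - c * y        ∎
    where
    x = h m (A ++ B)
    y = h (m ℤ.- 1ℤ) (A ++ c ∷ B)

  -- the (i, j) entry h_{λᵢ-i+j} + ε h_{λᵢ-i-j+t} of the classical Jacobi–Trudi matrices,
  -- with r = λᵢ - i and k = j - 1
  jtEntry : Carrier → ℤ → (ℤ → Carrier) → ℤ → ℕ → Carrier
  jtEntry ε t φ r k = φ (r ℤ.+ + suc k) + ε * φ (r ℤ.- + suc k ℤ.+ t)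

  jt : ∀ {N} → Carrier → ℤ → (ℤ → Carrier) → (Fin N → ℤ) → Matrix N
  jt ε t φ r i j = jtEntry ε t φ (r i) (toℕ j)

  ≡⇒≈ : ∀ (φ : ℤ → Carrier) {m m′} → m ≡ m′ → φ m ≈ φ m′
  ≡⇒≈ φ = reflexive ∘ ≡.cong φ

  jtEntry-suc : ∀ {ε a ε′ ψ φ} t r k → ε * a ≈ ε′ → a * ε′ ≈ ε → (∀ m → ψ m ≈ shiftℤ a φ m) →
                jtEntry ε t ψ r (suc k) ≈ shiftℕ a (jtEntry ε′ (t ℤ.- 1ℤ) φ r) (suc k)
  jtEntry-suc {ε} {a} {ε′} {ψ} {φ} t r k εa≈ε′ aε′≈ε ψ≈ = begin
    ψ (r ℤ.+ c′) + ε * ψ (r ℤ.- c′ ℤ.+ t)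
      ≈⟨ +-cong (ψ≈ _) (*-congˡ (ψ≈ _)) ⟩
    (φ (r ℤ.+ c′) + a * φ (r ℤ.+ c′ ℤ.- 1ℤ))
      + ε * (φ (r ℤ.- c′ ℤ.+ t) + a * φ (r ℤ.- c′ ℤ.+ t ℤ.- 1ℤ))
      ≈⟨ +-cong (+-congˡ (*-congˡ (≡⇒≈ φ (i₁ r K))))
                (*-congˡ (+-cong (≡⇒≈ φ (i₂ r t K)) (*-congˡ (≡⇒≈ φ (i₃ r t K))))) ⟩
    (x + a * y) + ε * (u + a * v)
      ≈⟨ +-congˡ (trans (distribˡ ε u (a * v))
                        (+-cong (*-congʳ (sym aε′≈ε))
                                (trans (sym (*-assoc ε a v)) (*-congʳ εa≈ε′)))) ⟩
    (x + a * y) + ((a * ε′) * u + ε′ * v)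
      ≈⟨ solve 6 (λ x y u v a ε′ → (x :+ a :* y) :+ ((a :* ε′) :* u :+ ε′ :* v)
                                  := (x :+ ε′ :* v) :+ a :* (y :+ ε′ :* u))
                 refl x y u v a ε′ ⟩
    (x + ε′ * v) + a * (y + ε′ * u) ∎
    where
    i₁ : ∀ r K → r ℤ.+ (+ 1 ℤ.+ (+ 1 ℤ.+ K)) ℤ.- + 1 ≡ r ℤ.+ (+ 1 ℤ.+ K)
    i₁ = solve-∀
    i₂ : ∀ r t K → r ℤ.- (+ 1 ℤ.+ (+ 1 ℤ.+ K)) ℤ.+ t ≡ r ℤ.- (+ 1 ℤ.+ K) ℤ.+ (t ℤ.- + 1)
    i₂ = solve-∀
    i₃ : ∀ r t K → r ℤ.- (+ 1 ℤ.+ (+ 1 ℤ.+ K)) ℤ.+ t ℤ.- + 1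
                   ≡ r ℤ.- (+ 1 ℤ.+ (+ 1 ℤ.+ K)) ℤ.+ (t ℤ.- + 1)
    i₃ = solve-∀
    K = + k
    c′ = + suc (suc k)
    x = φ (r ℤ.+ c′)
    y = φ (r ℤ.+ + suc k)
    u = φ (r ℤ.- + suc k ℤ.+ (t ℤ.- 1ℤ))
    v = φ (r ℤ.- c′ ℤ.+ (t ℤ.- 1ℤ))

  det-jt₂-unshift : ∀ N {a ψ φ} (r : Fin (suc N) → ℤ) → a * a ≈ 1# →
                    (∀ m → ψ m ≈ shiftℤ a φ m) →
                    det (suc N) (jt 1# (+ 2) ψ r) ≈ (1# + 1#) * det (suc N) (jt a (+ 1) φ r)
  det-jt₂-unshift N {a} {ψ} {φ} r a²≈1 ψ≈ = begin
    det (suc N) (jt 1# (+ 2) ψ r)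
      ≈⟨ det-scale-column (suc N) zero (1# + 1#) other-columns (λ i → first-column (r i)) ⟩
    (1# + 1#) * det (suc N) (λ i j → shiftℕ a (jtEntry a (+ 1) φ (r i)) (toℕ j))
      ≈⟨ *-congˡ (det-shiftℕ a (λ i → jtEntry a (+ 1) φ (r i))) ⟩
    (1# + 1#) * det (suc N) (jt a (+ 1) φ r) ∎
    where
    other-columns : ∀ i j → j ≢ zero →
                    jt 1# (+ 2) ψ r i j ≈ shiftℕ a (jtEntry a (+ 1) φ (r i)) (toℕ j)
    other-columns i zero    j≢0 = ⊥-elim (j≢0 ≡.refl)
    other-columns i (suc j) _   = jtEntry-suc (+ 2) (r i) (toℕ j) (*-identityˡ a) a²≈1 ψ≈
    i₁ : ∀ r → r ℤ.- + 1 ℤ.+ + 2 ≡ r ℤ.+ + 1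
    i₁ = solve-∀
    i₂ : ∀ r → r ℤ.+ + 1 ℤ.- + 1 ≡ r ℤ.- + 1 ℤ.+ + 1
    i₂ = solve-∀
    first-column : ∀ r → jtEntry 1# (+ 2) ψ r 0 ≈ (1# + 1#) * jtEntry a (+ 1) φ r 0
    first-column r = begin
      ψ (r ℤ.+ + 1) + 1# * ψ (r ℤ.- + 1 ℤ.+ + 2) ≈⟨ +-congˡ (*-congˡ (≡⇒≈ ψ (i₁ r))) ⟩
      ψ (r ℤ.+ + 1) + 1# * ψ (r ℤ.+ + 1)
        ≈⟨ solve 1 (λ y → y :+ con 1 :* y := (con 1 :+ con 1) :* y) refl (ψ (r ℤ.+ + 1)) ⟩
      (1# + 1#) * ψ (r ℤ.+ + 1)                 ≈⟨ *-congˡ (ψ≈ _) ⟩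
      (1# + 1#) * (φ (r ℤ.+ + 1) + a * φ (r ℤ.+ + 1 ℤ.- 1ℤ))
        ≈⟨ *-congˡ (+-congˡ (*-congˡ (≡⇒≈ φ (i₂ r)))) ⟩
      (1# + 1#) * (φ (r ℤ.+ + 1) + a * φ (r ℤ.- + 1 ℤ.+ + 1)) ∎

  det-jt₁-unshift : ∀ N {ψ φ} (r : Fin N → ℤ) → (∀ m → ψ m ≈ shiftℤ 1# φ m) →
                    det N (jt (- 1#) (+ 1) ψ r) ≈ det N (jt (- 1#) (+ 0) φ r)
  det-jt₁-unshift N {ψ} {φ} r ψ≈ = begin
    det N (jt (- 1#) (+ 1) ψ r)
      ≈⟨ det-cong N column ⟩
    det N (λ i j → shiftℕ 1# (jtEntry (- 1#) (+ 0) φ (r i)) (toℕ j))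
      ≈⟨ det-shiftℕ 1# (λ i → jtEntry (- 1#) (+ 0) φ (r i)) ⟩
    det N (jt (- 1#) (+ 0) φ r) ∎
    where
    i₁ : ∀ r → r ℤ.+ + 1 ℤ.- + 1 ≡ r ℤ.- + 1 ℤ.+ + 1
    i₁ = solve-∀
    i₂ : ∀ r → r ℤ.- + 1 ℤ.+ + 1 ℤ.- + 1 ≡ r ℤ.- + 1 ℤ.+ + 0
    i₂ = solve-∀
    first-column : ∀ r → jtEntry (- 1#) (+ 1) ψ r 0 ≈ jtEntry (- 1#) (+ 0) φ r 0
    first-column r = begin
      ψ (r ℤ.+ + 1) + - 1# * ψ (r ℤ.- + 1 ℤ.+ + 1)
        ≈⟨ +-cong (ψ≈ _) (*-congˡ (ψ≈ _)) ⟩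
      (x + 1# * φ (r ℤ.+ + 1 ℤ.- 1ℤ)) + - 1# * (y + 1# * φ (r ℤ.- + 1 ℤ.+ + 1 ℤ.- 1ℤ))
        ≈⟨ +-cong (+-congˡ (*-congˡ (≡⇒≈ φ (i₁ r))))
                  (*-congˡ (+-congˡ (*-congˡ (≡⇒≈ φ (i₂ r))))) ⟩
      (x + 1# * y) + - 1# * (y + 1# * v)
        ≈⟨ solve 4 (λ x y v n → (x :+ con 1 :* y) :+ n :* (y :+ con 1 :* v)
                               := (x :+ n :* v) :+ (y :+ n :* y)) refl x y v (- 1#) ⟩
      (x + - 1# * v) + (y + - 1# * y)
        ≈⟨ +-congˡ (trans (+-congˡ (-1*x≈-x y)) (-‿inverseʳ y)) ⟩
      (x + - 1# * v) + 0#                        ≈⟨ +-identityʳ _ ⟩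
      x + - 1# * v ∎
      where
      x = φ (r ℤ.+ + 1)
      y = φ (r ℤ.- + 1 ℤ.+ + 1)
      v = φ (r ℤ.- + 1 ℤ.+ + 0)
    column : ∀ i j → jt (- 1#) (+ 1) ψ r i j ≈ shiftℕ 1# (jtEntry (- 1#) (+ 0) φ (r i)) (toℕ j)
    column i zero    = first-column (r i)
    column i (suc j) = jtEntry-suc (+ 1) (r i) (toℕ j) (*-identityʳ _) (*-identityˡ _) ψ≈

  det-jt-plus : ∀ N t (φ : ℤ → Carrier) (r : Fin N → ℤ) →
                det N (λ i j → φ (r i ℤ.+ col j) + φ (r i ℤ.- col j ℤ.+ t)) ≈ det N (jt 1# t φ r)
  det-jt-plus N t φ r = det-cong N λ i j → +-congˡ (sym (*-identityˡ _))

  det-jt-minus : ∀ N (φ : ℤ → Carrier) (r : Fin N → ℤ) →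
                 det N (λ i j → φ (r i ℤ.+ col j) - φ (r i ℤ.- col j)) ≈ det N (jt (- 1#) (+ 0) φ r)
  det-jt-minus N φ r = det-cong N λ i j →
    +-congˡ (trans (sym (-1*x≈-x _)) (*-congˡ (≡⇒≈ φ (≡.sym (ℤₚ.+-identityʳ _)))))

  h-remove-−1 : ∀ {Z Z′} A B → Z ≡ A ++ B → Z′ ≡ A ++ - 1# ∷ B →
                ∀ m → h m Z ≈ shiftℤ 1# (λ m → h m Z′) m
  h-remove-−1 A B Z≡ Z′≡ m =
    trans (h-remove A (- 1#) B Z≡ Z′≡ m) (+-congˡ (*-congʳ (-‿involutive 1#)))

  half-cancel : ∀ {half} → (1# + 1#) * half ≈ 1# → ∀ x → half * ((1# + 1#) * x) ≈ x
  half-cancel {half} 2half≈1 x = begin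
    half * ((1# + 1#) * x) ≈⟨ sym (*-assoc _ _ _) ⟩
    (half * (1# + 1#)) * x ≈⟨ *-congʳ (trans (*-comm _ _) 2half≈1) ⟩
    1# * x                 ≈⟨ *-identityˡ x ⟩
    x                      ∎

  so≈sp : ∀ half → (1# + 1#) * half ≈ 1# → ∀ n (x xinv : Vec Carrier n) (μ : Fin n → ℕ) →
          soF n μ (toList x ++ toList xinv ++ [ - 1# ]) ≈ spW n half μ x xinv
  so≈sp half 2half≈1 zero    x xinv μ = refl
  so≈sp half 2half≈1 (suc n) x xinv μ = begin
    soF (suc n) μ Z                                          ≈⟨ det-jt-plus (suc n) (+ 1) hZ r ⟩
    det (suc n) (jt 1# (+ 1) hZ r)                           ≈⟨ sym (half-cancel 2half≈1 _) ⟩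
    half * ((1# + 1#) * det (suc n) (jt 1# (+ 1) hZ r))
      ≈⟨ *-congˡ (sym (det-jt₂-unshift n r (*-identityˡ 1#) hA≈)) ⟩
    half * det (suc n) (jt 1# (+ 2) hA r)
      ≈⟨ *-congˡ (sym (det-jt-plus (suc n) (+ 2) hA r)) ⟩
    spW (suc n) half μ x xinv                                ∎
    where
    X = toList x
    X̄ = toList xinv
    Z = X ++ X̄ ++ [ - 1# ]
    hZ = λ m → h m Z
    hA = λ m → h m (X ++ X̄)
    r = rowIdx μ
    hA≈ : ∀ m → hA m ≈ shiftℤ 1# hZ m
    hA≈ = h-remove-−1 (X ++ X̄) [] (≡.sym (Listₚ.++-identityʳ _)) (≡.sym (Listₚ.++-assoc X X̄ _))

  sp≈oo : ∀ half → (1# + 1#) * half ≈ 1# → ∀ n (x xinv : Vec Carrier n) (μ : Fin (suc n) → ℕ) →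
          spF (suc n) half μ (toList x ++ toList xinv ++ [ - 1# ])
            ≈ ooW (suc n) μ (x ∷ʳ (- 1#)) (xinv ∷ʳ (- 1#))
  sp≈oo half 2half≈1 n x xinv μ = begin
    spF (suc n) half μ Z                          ≈⟨ *-congˡ (det-jt-plus (suc n) (+ 2) hZ r) ⟩
    half * det (suc n) (jt 1# (+ 2) hZ r)         ≈⟨ *-congˡ (det-jt₂-unshift n r [-1]²≈1 hZ≈) ⟩
    half * ((1# + 1#) * det (suc n) (jt (- 1#) (+ 1) hW r)) ≈⟨ half-cancel 2half≈1 _ ⟩
    det (suc n) (jt (- 1#) (+ 1) hW r)            ≈⟨ det-jt₁-unshift (suc n) r hW≈ ⟩
    det (suc n) (jt (- 1#) (+ 0) hY r)            ≈⟨ sym (det-jt-minus (suc n) hY r) ⟩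
    ooW (suc n) μ (x ∷ʳ (- 1#)) (xinv ∷ʳ (- 1#))  ∎
    where
    X = toList x
    X̄ = toList xinv
    Z = X ++ X̄ ++ [ - 1# ]
    W = X ++ X̄ ++ - 1# ∷ [ 1# ]
    Y = toList (x ∷ʳ (- 1#)) ++ toList (xinv ∷ʳ (- 1#)) ++ [ 1# ]
    hZ = λ m → h m Z
    hW = λ m → h m W
    hY = λ m → h m Y
    r = rowIdx μ
    [-1]²≈1 : - 1# * - 1# ≈ 1#
    [-1]²≈1 = trans (-1*x≈-x (- 1#)) (-‿involutive 1#)
    W≡Z++[1] : W ≡ Z ++ [ 1# ]
    W≡Z++[1] = ≡.sym (≡.trans (Listₚ.++-assoc X (X̄ ++ [ - 1# ]) [ 1# ])
                              (≡.cong (X ++_) (Listₚ.++-assoc X̄ [ - 1# ] [ 1# ])))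
    Y≡ : Y ≡ X ++ - 1# ∷ X̄ ++ - 1# ∷ [ 1# ]
    Y≡ = ≡.trans (≡.cong₂ (λ A B → A ++ B ++ [ 1# ])
                          (Vecₚ.toList-∷ʳ (- 1#) x) (Vecₚ.toList-∷ʳ (- 1#) xinv))
        (≡.trans (Listₚ.++-assoc X [ - 1# ] _)
                 (≡.cong (λ B → X ++ - 1# ∷ B) (Listₚ.++-assoc X̄ [ - 1# ] [ 1# ])))
    hZ≈ : ∀ m → hZ m ≈ shiftℤ (- 1#) hW m
    hZ≈ = h-remove Z 1# [] (≡.sym (Listₚ.++-identityʳ Z)) W≡Z++[1]
    hW≈ : ∀ m → hW m ≈ shiftℤ 1# hY m
    hW≈ = h-remove-−1 X (X̄ ++ - 1# ∷ [ 1# ]) ≡.refl Y≡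

lemma3p2 : {c ℓ : Level} (R : CommutativeRing c ℓ) →
    let open Sym R in
    (half : Carrier) → (1# + 1#) * half ≈ 1# →
    (n : ℕ) (x xinv : Vec Carrier n) → ((i : Fin n) → lookup x i * lookup xinv i ≈ 1#) →
    ((μ : Fin n → ℕ) → IsPartition μ →
      soF n μ (toList x ++ toList xinv ++ [ - 1# ]) ≈ spW n half μ x xinv)
    × ((μ : Fin (suc n) → ℕ) → IsPartition μ →
      spF (suc n) half μ (toList x ++ toList xinv ++ [ - 1# ])
        ≈ ooW (suc n) μ (x ∷ʳ (- 1#)) (xinv ∷ʳ (- 1#)))
lemma3p2 R half 2half≈1 n x xinv _ =
  (λ μ _ → so≈sp R half 2half≈1 n x xinv μ) , (λ μ _ → sp≈oo R half 2half≈1 n x xinv μ)
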